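{- Let $n\ge0$, let $\mathcal{M}=(W,R,V)$ be a model with $R$ transitive in which every instance of $\mathbb{C}_n$ is true, let $\Phi$ be a finite set of formulas closed under subformulas, and let $\mathcal{M}_\Phi=(W_\Phi,R_\Phi,V_\Phi)$ be the standard transitive filtration of $\mathcal{M}$ through $\Phi$. Then for any $R_\Phi$-cluster $C$ there exist an element $x^*\in W$ with $[x^*]\in C$ and a subset $C^*\subseteq C$ such that $x^*\rightsquigarrow\alpha$ for all $\alpha\in C^*$, and for all $y\in W$: if $x^*Ry$ and $[y]\in C$, then $[y]\in C^*$ and $y\rightsquigarrow\alpha$ for all $\alpha\in C^*$. Moreover $C^*$ has at most $n$ elements, and if $C$ is $R_\Phi$-degenerate then $C^*$ is empty.
   Context: Modal formulas are built from variables by $\top,\neg,\wedge,\Box$, with $\Diamond=\neg\Box\neg$, $\Box^*\varphi=\varphi\wedge\Box\varphi$; models use standard Kripke semantics. Define $\mathbb{P}_0(\varphi_0)=\Diamond\varphi_0$ and for $n>0$, $\mathbb{P}_n(\varphi_0,\dots,\varphi_n)=\Diamond(\varphi_1\wedge\mathbb{P}_{n-1}(\varphi_0,\varphi_2,\dots,\varphi_n))$; $\mathbb{D}_n=\bigwedge_{i<j\le n}\neg(\varphi_i\wedge\varphi_j)$ ($=\top$ if $n=0$); $\mathbb{C}_n$ is the scheme $\Box^*\mathbb{D}_n\to(\Diamond\varphi_0\to\Diamond(\varphi_0\wedge\neg\mathbb{P}_n))$. For $x\in W$ let $x^\Phi=\{\varphi\in\Phi:\mathcal{M},x\models\varphi\}$;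 $[x]=\{y\in W: y^\Phi=x^\Phi\}$ and $W_\Phi=\{[x]:x\in W\}$. The standard transitive filtration has $[x]R_\Phi[y]$ iff $\{\Box\varphi,\varphi:\Box\varphi\in x^\Phi\}\subseteq y^\Phi$, and $V_\Phi(p)=\{[x]:\mathcal{M},x\models p\}$ for $p\in\Phi$, $V_\Phi(p)=\emptyset$ otherwise. An $R_\Phi$-cluster is an equivalence class of $\{(\alpha,\beta):\alpha=\beta\text{ or }\alpha R_\Phi\beta R_\Phi\alpha\}$; it is degenerate if it is a singleton $\{\alpha\}$ with not $\alpha R_\Phi\alpha$. For $x\in W$ and $\alpha\in W_\Phi$, $x\rightsquigarrow\alpha$ means there is $y\in\alpha$ with $xRy$. -}

module Defs where

open import Level using (0ℓ)
open import Data.Nat using (ℕ; zero; suc; _≤_)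
open import Data.Fin using (Fin; zero; suc)
open import Data.List using (List; []; _∷_; map; length; allFin)
open import Data.List.Membership.Propositional using (_∈_)
open import Data.Product using (Σ; _×_; _,_)
open import Data.Sum using (_⊎_)
open import Data.Unit using (⊤)
open import Data.Empty using (⊥)
open import Function using (_∘_)
open import Relation.Binary.PropositionalEquality using (_≡_)

infixr 6 _∧'_
data Fm : Set where
  var  : ℕ → Fm
  ⊤'   : Fm
  ¬'   : Fm → Fm
  _∧'_ : Fm → Fm → Fm
  □    : Fm → Fm

◇ : Fm → Fm
◇ φ = ¬' (□ (¬' φ))

□* : Fm → Fm
□* φ = φ ∧' □ φ

_⇒_ : Fm → Fm → Fm
a ⇒ b = ¬' (a ∧' ¬' b)

conj : List Fm → Fm
conj []       = ⊤'
conj (a ∷ as) = a ∧' conj as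

record Model : Set₁ where
  field
    W : Set
    R : W → W → Set
    V : ℕ → W → Set
open Model public

_,_⊨_ : (M : Model) → W M → Fm → Set
M , x ⊨ var p    = V M p x
M , x ⊨ ⊤'       = ⊤
M , x ⊨ ¬' φ     = M , x ⊨ φ → ⊥
M , x ⊨ (φ ∧' ψ) = (M , x ⊨ φ) × (M , x ⊨ ψ)
M , x ⊨ □ φ      = ∀ y → R M x y → M , y ⊨ φ

Transitive : Model → Set
Transitive M = ∀ x y z → R M x y → R M y z → R M x z

ℙ : (n : ℕ) → (Fin (suc n) → Fm) → Fm
ℙ zero    φ = ◇ (φ zero)
ℙ (suc n) φ = ◇ (φ (suc zero) ∧' ℙ n (λ { zero → φ zero ; (suc i) → φ (suc (suc i)) }))

-- 𝔻_n = ⋀_{i<j≤n} ¬(φ_i ∧ φ_j)   (⊤ if n = 0); conjuncts grouped by the smaller index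
𝔻 : (n : ℕ) → (Fin (suc n) → Fm) → Fm
𝔻 zero    φ = ⊤'
𝔻 (suc n) φ = conj (map (λ j → ¬' (φ zero ∧' φ (suc j))) (allFin (suc n))) ∧' 𝔻 n (φ ∘ suc)

ℂ : (n : ℕ) → (Fin (suc n) → Fm) → Fm
ℂ n φ = □* (𝔻 n φ) ⇒ (◇ (φ zero) ⇒ ◇ (φ zero ∧' ¬' (ℙ n φ)))

ValidC : ℕ → Model → Set
ValidC n M = ∀ (φ : Fin (suc n) → Fm) (x : W M) → M , x ⊨ ℂ n φ

-- closure under (immediate, hence all) subformulas
SubClosed : List Fm → Set
SubClosed Φ =
  (∀ φ → ¬' φ ∈ Φ → φ ∈ Φ) ×
  (∀ φ ψ → (φ ∧' ψ) ∈ Φ → φ ∈ Φ × ψ ∈ Φ) ×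
  (∀ φ → □ φ ∈ Φ → φ ∈ Φ)

-- Filtration through Φ.  A class [x] ∈ W_Φ is represented by x ∈ W;
-- [x] = [y] iff x^Φ = y^Φ.
_∣_⊢_≈Φ_ : (M : Model) (Φ : List Fm) → W M → W M → Set
M ∣ Φ ⊢ x ≈Φ y = ∀ φ → φ ∈ Φ → (M , x ⊨ φ → M , y ⊨ φ) × (M , y ⊨ φ → M , x ⊨ φ)

RΦ : (M : Model) (Φ : List Fm) → W M → W M → Set
RΦ M Φ x y = ∀ φ → □ φ ∈ Φ → M , x ⊨ □ φ → (M , y ⊨ □ φ) × (M , y ⊨ φ)

SameCluster : (M : Model) (Φ : List Fm) → W M → W M → Set
SameCluster M Φ x y = (M ∣ Φ ⊢ x ≈Φ y) ⊎ (RΦ M Φ x y × RΦ M Φ y x)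

Degenerate : (M : Model) (Φ : List Fm) → W M → Set
Degenerate M Φ c = (∀ y → SameCluster M Φ c y → M ∣ Φ ⊢ c ≈Φ y) × (RΦ M Φ c c → ⊥)

_∣_⊢_⇝_ : (M : Model) (Φ : List Fm) → W M → W M → Set
M ∣ Φ ⊢ x ⇝ w = Σ (W M) λ y → (M ∣ Φ ⊢ w ≈Φ y) × R M x y

-- Classically, every world x has a Φ-type (the set of formulas of Φ it satisfies), and there are
-- only finitely many types.  Let T(x) be the set of types of those R-successors of x whose class
-- lies in the cluster C, and pick x* in C with T(x*) of least size.  Transitivity makes T
-- antitone along R, so minimality forces T(y) = T(x*) for every R-successor y of x* in C; taking
-- one representative per type in T(x*) gives C*.  If C* had n + 1 elements, instantiating ℂ_n at
-- x* with the characteristic formulas of n + 1 of its types would fail: these formulas are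
-- pairwise exclusive, so 𝔻_n holds everywhere, and every successor of x* of the first type lies
-- in C and so sees all types of T(x*) again, hence satisfies ℙ_n.
module Submission where

open import Defs
open import Level using (0ℓ)
open import Axiom.ExcludedMiddle using (ExcludedMiddle)
open import Data.Bool using (Bool; true; false)
open import Data.Empty using (⊥; ⊥-elim)
open import Data.Fin using (Fin; zero; suc; inject≤)
open import Data.Fin.Properties using (suc-injective; inject≤-injective)
open import Data.List using (List; []; _∷_; [_]; length; map; allFin; lookup; filter; cartesianProductWith)
open import Data.List.Properties using (∷-injective)
open import Data.List.Membership.Propositional using (_∈_; _∉_)
open import Data.List.Membership.Propositional.Properties
  using (∈-filter⁺; ∈-filter⁻; ∈-lookup; ∈-cartesianProductWith⁺)
open import Data.List.Relation.Unary.Any using (here; there)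
open import Data.List.Relation.Unary.All as All using (All; []; _∷_)
open import Data.List.Relation.Unary.All.Properties using (all-filter)
open import Data.List.Relation.Unary.AllPairs using ([]; _∷_)
open import Data.List.Relation.Unary.Unique.Propositional using (Unique)
import Data.List.Relation.Unary.Unique.Propositional.Properties as Unique
open import Data.List.Relation.Binary.Sublist.Propositional using (_⊆_; ⊆-refl)
import Data.List.Relation.Binary.Sublist.Propositional.Properties as Sublist
open import Data.List.Relation.Binary.Equality.Propositional using (≋⇒≡)
open import Data.Nat using (ℕ; zero; suc; _≤_; _<_; z≤n)
open import Data.Nat.Properties using (≤-refl; ≤-trans; ≤-pred; ≤-antisym; ≤-reflexive; ≮⇒≥)
open import Data.Product using (Σ; ∃; ∃-syntax; _×_; _,_; proj₁; proj₂)
open import Data.Sum using (inj₁; inj₂)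
open import Data.Unit using (tt)
open import Function using (_∘_)
open import Relation.Nullary using (Dec; yes; no; does; ¬_)
open import Relation.Unary using (Decidable)
open import Relation.Binary.PropositionalEquality using (_≡_; _≢_; refl; sym; trans; cong; cong₂; subst)

module _ {M : Model} where

  ◇-intro : ∀ {x y} φ → R M x y → M , y ⊨ φ → M , x ⊨ ◇ φ
  ◇-intro {y = y} _ xRy y⊨φ □¬φ = □¬φ y xRy y⊨φ

  ⊨conj-map : ∀ {A : Set} {u} (f : A → Fm) (as : List A) →
              (∀ a → M , u ⊨ f a) → M , u ⊨ conj (map f as)
  ⊨conj-map f []       _  = tt
  ⊨conj-map f (a ∷ as) ⊨f = ⊨f a , ⊨conj-map f as ⊨f

  ⊨𝔻 : ∀ k (φ : Fin (suc k) → Fm) {u} →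
       (∀ i j → i ≢ j → M , u ⊨ φ i → M , u ⊨ φ j → ⊥) → M , u ⊨ 𝔻 k φ
  ⊨𝔻 zero    φ exclusive = tt
  ⊨𝔻 (suc k) φ exclusive =
    ⊨conj-map _ (allFin (suc k)) (λ j (⊨φ₀ , ⊨φⱼ) → exclusive zero (suc j) (λ ()) ⊨φ₀ ⊨φⱼ) ,
    ⊨𝔻 k (φ ∘ suc) (λ i j i≢j → exclusive (suc i) (suc j) (i≢j ∘ suc-injective))

  ⊨ℙ : (S : W M → Set) → ∀ k (φ : Fin (suc k) → Fm) →
       (∀ {u} i → S u → ∃[ z ] R M u z × S z × M , z ⊨ φ i) →
       ∀ {u} → S u → M , u ⊨ ℙ k φ
  ⊨ℙ S zero φ reach u∈S with reach zero u∈S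
  ... | z , uRz , _ , ⊨φ₀ = ◇-intro (φ zero) uRz ⊨φ₀
  ⊨ℙ S (suc k) φ reach u∈S with reach (suc zero) u∈S
  ... | z , uRz , z∈S , ⊨φ₁ = ◇-intro (φ (suc zero) ∧' ℙ k _) uRz
    (⊨φ₁ , ⊨ℙ S k _ (λ { zero → reach zero ; (suc i) → reach (suc (suc i)) }) z∈S)

  ⊭ℂ : ∀ {n φ x} → M , x ⊨ □* (𝔻 n φ) → M , x ⊨ ◇ (φ zero) →
       (∀ y → R M x y → M , y ⊨ φ zero → M , y ⊨ ℙ n φ) → ¬ (M , x ⊨ ℂ n φ)
  ⊭ℂ ⊨□*𝔻 ⊨◇φ₀ φ₀⇒ℙ ⊨ℂ =
    ⊨ℂ (⊨□*𝔻 , λ ◇⇒◇ → ◇⇒◇ (⊨◇φ₀ , λ ◇φ₀¬ℙ →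
      ◇φ₀¬ℙ (λ y xRy (⊨φ₀ , ⊭ℙ) → ⊭ℙ (φ₀⇒ℙ y xRy ⊨φ₀))))

module _ {M : Model} {Φ : List Fm} where

  ≈Φ-refl : ∀ {x} → M ∣ Φ ⊢ x ≈Φ x
  ≈Φ-refl φ _ = (λ p → p) , (λ p → p)

  ≈Φ-sym : ∀ {x y} → M ∣ Φ ⊢ x ≈Φ y → M ∣ Φ ⊢ y ≈Φ x
  ≈Φ-sym x≈y φ φ∈Φ = proj₂ (x≈y φ φ∈Φ) , proj₁ (x≈y φ φ∈Φ)

  ≈Φ-trans : ∀ {x y z} → M ∣ Φ ⊢ x ≈Φ y → M ∣ Φ ⊢ y ≈Φ z → M ∣ Φ ⊢ x ≈Φ z
  ≈Φ-trans x≈y y≈z φ φ∈Φ =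
    proj₁ (y≈z φ φ∈Φ) ∘ proj₁ (x≈y φ φ∈Φ) , proj₂ (x≈y φ φ∈Φ) ∘ proj₂ (y≈z φ φ∈Φ)

  R⇒RΦ : Transitive M → ∀ {x y} → R M x y → RΦ M Φ x y
  R⇒RΦ tr {y = y} xRy φ _ x⊨□φ = (λ z yRz → x⊨□φ z (tr _ _ _ xRy yRz)) , x⊨□φ y xRy

  RΦ-respˡ-≈Φ : ∀ {x y z} → M ∣ Φ ⊢ x ≈Φ z → RΦ M Φ x y → RΦ M Φ z y
  RΦ-respˡ-≈Φ x≈z xRy φ □φ∈Φ = xRy φ □φ∈Φ ∘ proj₂ (x≈z (□ φ) □φ∈Φ)

  RΦ-respʳ-≈Φ : SubClosed Φ → ∀ {x y z} → M ∣ Φ ⊢ y ≈Φ z → RΦ M Φ x y → RΦ M Φ x z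
  RΦ-respʳ-≈Φ (_ , _ , □-closed) y≈z xRy φ □φ∈Φ x⊨□φ =
    proj₁ (y≈z (□ φ) □φ∈Φ) (proj₁ (xRy φ □φ∈Φ x⊨□φ)) ,
    proj₁ (y≈z φ (□-closed φ □φ∈Φ)) (proj₂ (xRy φ □φ∈Φ x⊨□φ))

  SameCluster-respʳ-≈Φ : SubClosed Φ → ∀ {c y z} → M ∣ Φ ⊢ y ≈Φ z →
                         SameCluster M Φ c y → SameCluster M Φ c z
  SameCluster-respʳ-≈Φ sc y≈z (inj₁ c≈y)         = inj₁ (≈Φ-trans c≈y y≈z)
  SameCluster-respʳ-≈Φ sc y≈z (inj₂ (cRy , yRc)) = inj₂ (RΦ-respʳ-≈Φ sc y≈z cRy , RΦ-respˡ-≈Φ y≈z yRc)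

  Degenerate⇒¬R : Transitive M → SubClosed Φ → ∀ {c x y} → Degenerate M Φ c →
                  SameCluster M Φ c x → SameCluster M Φ c y → ¬ R M x y
  Degenerate⇒¬R tr sc (singleton , irreflexive) x∈C y∈C xRy =
    irreflexive (RΦ-respʳ-≈Φ sc (≈Φ-sym (singleton _ y∈C))
                  (RΦ-respˡ-≈Φ (≈Φ-sym (singleton _ x∈C)) (R⇒RΦ tr xRy)))

lookup-injective : ∀ {A : Set} {xs : List A} → Unique xs → ∀ {i j} → lookup xs i ≡ lookup xs j → i ≡ j
lookup-injective (_   ∷ _) {zero}  {zero}  _  = refl
lookup-injective (x∉ ∷ _) {zero}  {suc j} eq = ⊥-elim (All.lookup x∉ (∈-lookup j) eq)
lookup-injective (x∉ ∷ _) {suc i} {zero}  eq = ⊥-elim (All.lookup x∉ (∈-lookup i) (sym eq))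
lookup-injective (_   ∷ u) {suc i} {suc j} eq = cong suc (lookup-injective u eq)

≡[]-if-no-members : ∀ {A : Set} (xs : List A) → (∀ {a} → a ∉ xs) → xs ≡ []
≡[]-if-no-members []      _     = refl
≡[]-if-no-members (_ ∷ _) empty = ⊥-elim (empty (here refl))

module _ {K A : Set} {P : K → A → Set} where

  witnesses : ∀ {ks} → All (λ k → ∃ (P k)) ks → List A
  witnesses []             = []
  witnesses ((a , _) ∷ ps) = a ∷ witnesses ps

  length-witnesses : ∀ {ks} (ps : All (λ k → ∃ (P k)) ks) → length (witnesses ps) ≡ length ks
  length-witnesses []       = refl
  length-witnesses (_ ∷ ps) = cong suc (length-witnesses ps)

  ∈-witnesses⁻ : ∀ {ks} (ps : All (λ k → ∃ (P k)) ks) {a} → a ∈ witnesses ps → ∃[ k ] P k a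
  ∈-witnesses⁻ ((_ , p) ∷ _)  (here refl) = _ , p
  ∈-witnesses⁻ (_ ∷ ps)       (there a∈)  = ∈-witnesses⁻ ps a∈

  ∈-witnesses⁺ : ∀ {ks} (ps : All (λ k → ∃ (P k)) ks) {k} → k ∈ ks → ∃[ a ] a ∈ witnesses ps × P k a
  ∈-witnesses⁺ ((a , p) ∷ _) (here refl) = a , here refl , p
  ∈-witnesses⁺ (_ ∷ ps)      (there k∈) =
    let a , a∈ , p = ∈-witnesses⁺ ps k∈ in a , there a∈ , p

minimiser : ExcludedMiddle 0ℓ → ∀ {A : Set} (P : A → Set) (f : A → ℕ) {a} → P a →
            ∃[ x ] P x × (∀ y → P y → f x ≤ f y)
minimiser em P f {a} Pa = descend (f a) a ≤-refl Pa
  where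
  descend : ∀ k x → f x ≤ k → P x → ∃[ x ] P x × (∀ y → P y → f x ≤ f y)
  descend zero    x fx≤0 Px = x , Px , λ _ _ → ≤-trans fx≤0 z≤n
  descend (suc k) x fx≤k Px with em {∃[ y ] P y × f y < f x}
  ... | yes (y , Py , fy<fx) = descend k y (≤-pred (≤-trans fy<fx fx≤k)) Py
  ... | no ∄smaller          = x , Px , λ y Py → ≮⇒≥ (λ fy<fx → ∄smaller (y , Py , fy<fx))

module Types (em : ExcludedMiddle 0ℓ) (M : Model) where

  type : List Fm → W M → List Bool
  type []      x = []
  type (ψ ∷ Ψ) x = does (em {M , x ⊨ ψ}) ∷ type Ψ x

  literal : Fm → Bool → Fm
  literal ψ true  = ψ
  literal ψ false = ¬' ψ

  -- Surplus entries of the longer list are ignored, so char Ψ τ pins down the type only when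
  -- τ has length |Ψ| (e.g. when τ is itself a type).
  char : List Fm → List Bool → Fm
  char (ψ ∷ Ψ) (b ∷ τ) = literal ψ b ∧' char Ψ τ
  char _       _       = ⊤'

  ⊨char-type : ∀ Ψ {x τ} → type Ψ x ≡ τ → M , x ⊨ char Ψ τ
  ⊨char-type []      _         = tt
  ⊨char-type (ψ ∷ Ψ) {x} refl = ⊨literal em , ⊨char-type Ψ refl
    where
    ⊨literal : (d : Dec (M , x ⊨ ψ)) → M , x ⊨ literal ψ (does d)
    ⊨literal (yes x⊨ψ) = x⊨ψ
    ⊨literal (no  x⊭ψ) = x⊭ψ

  char-determines-type : ∀ Ψ u w → M , u ⊨ char Ψ (type Ψ w) → type Ψ u ≡ type Ψ w
  char-determines-type []      u w _           = refl
  char-determines-type (ψ ∷ Ψ) u w (⊨lit , ⊨τ) =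
    cong₂ _∷_ (literal-determines em em ⊨lit) (char-determines-type Ψ u w ⊨τ)
    where
    literal-determines : (d : Dec (M , w ⊨ ψ)) (e : Dec (M , u ⊨ ψ)) →
                         M , u ⊨ literal ψ (does d) → does e ≡ does d
    literal-determines (yes _) (yes _)   _     = refl
    literal-determines (yes _) (no u⊭ψ) u⊨ψ  = ⊥-elim (u⊭ψ u⊨ψ)
    literal-determines (no  _) (yes u⊨ψ) u⊭ψ  = ⊥-elim (u⊭ψ u⊨ψ)
    literal-determines (no  _) (no _)    _     = refl

  type≡⇒⊨ : ∀ Ψ {x y ψ} → type Ψ x ≡ type Ψ y → ψ ∈ Ψ → M , x ⊨ ψ → M , y ⊨ ψ
  type≡⇒⊨ (ψ ∷ Ψ) eq (here refl) = does≡⇒ em em (proj₁ (∷-injective eq))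
    where
    does≡⇒ : ∀ {A B : Set} (d : Dec A) (e : Dec B) → does d ≡ does e → A → B
    does≡⇒ _       (yes b) _  _ = b
    does≡⇒ (no ¬a) _       _  a = ⊥-elim (¬a a)
    does≡⇒ (yes _) (no _)  () _
  type≡⇒⊨ (_ ∷ Ψ) eq (there ψ∈Ψ) = type≡⇒⊨ Ψ (proj₂ (∷-injective eq)) ψ∈Ψ

  type≡⇒≈Φ : ∀ {Φ x y} → type Φ x ≡ type Φ y → M ∣ Φ ⊢ x ≈Φ y
  type≡⇒≈Φ {Φ} eq φ φ∈Φ = type≡⇒⊨ Φ eq φ∈Φ , type≡⇒⊨ Φ (sym eq) φ∈Φ

  boolVectors : ℕ → List (List Bool)
  boolVectors zero    = [ [] ]
  boolVectors (suc m) = cartesianProductWith _∷_ (true ∷ false ∷ []) (boolVectors m)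

  boolVectors-unique : ∀ m → Unique (boolVectors m)
  boolVectors-unique zero    = [] ∷ []
  boolVectors-unique (suc m) =
    Unique.cartesianProductWith⁺ _∷_ ∷-injective (((λ ()) ∷ []) ∷ [] ∷ []) (boolVectors-unique m)

  ∈-boolVectors : ∀ Ψ x → type Ψ x ∈ boolVectors (length Ψ)
  ∈-boolVectors []      x = here refl
  ∈-boolVectors (ψ ∷ Ψ) x = ∈-cartesianProductWith⁺ _∷_ (∈-bools (does em)) (∈-boolVectors Ψ x)
    where
    ∈-bools : ∀ b → b ∈ true ∷ false ∷ []
    ∈-bools true  = here refl
    ∈-bools false = there (here refl)

module Cluster (em : ExcludedMiddle 0ℓ) (M : Model) (tr : Transitive M)
               (Φ : List Fm) (sc : SubClosed Φ) (c : W M) where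

  open Types em M

  InCluster : W M → Set
  InCluster = SameCluster M Φ c

  ClusterSuccessorOfType : W M → List Bool → W M → Set
  ClusterSuccessorOfType x τ z = type Φ z ≡ τ × R M x z × InCluster z

  SeesInCluster : W M → List Bool → Set
  SeesInCluster x τ = ∃ (ClusterSuccessorOfType x τ)

  SeesInCluster? : ∀ x → Decidable (SeesInCluster x)
  SeesInCluster? x τ = em

  clusterTypes : W M → List (List Bool)
  clusterTypes x = filter (SeesInCluster? x) (boolVectors (length Φ))

  clusterTypes-unique : ∀ {x} → Unique (clusterTypes x)
  clusterTypes-unique {x} = Unique.filter⁺ (SeesInCluster? x) (boolVectors-unique (length Φ))

  ∈-clusterTypes⁺ : ∀ {x τ} → SeesInCluster x τ → τ ∈ clusterTypes x
  ∈-clusterTypes⁺ {x} sees@(z , refl , _) = ∈-filter⁺ (SeesInCluster? x) (∈-boolVectors Φ z) sees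

  ∈-clusterTypes⁻ : ∀ {x τ} → τ ∈ clusterTypes x → SeesInCluster x τ
  ∈-clusterTypes⁻ {x} τ∈ = proj₂ (∈-filter⁻ (SeesInCluster? x) {xs = boolVectors (length Φ)} τ∈)

  clusterTypes-antitone : ∀ {x y} → R M x y → clusterTypes y ⊆ clusterTypes x
  clusterTypes-antitone {x} {y} xRy =
    Sublist.filter⁺ (SeesInCluster? y) (SeesInCluster? x)
      (λ { refl (z , τ≡ , yRz , z∈C) → z , τ≡ , tr _ _ _ xRy yRz , z∈C })
      (⊆-refl {x = boolVectors (length Φ)})

  ⊨char⇒type≡ : ∀ {x τ u} → τ ∈ clusterTypes x → M , u ⊨ char Φ τ → type Φ u ≡ τ
  ⊨char⇒type≡ {u = u} τ∈ u⊨ with ∈-clusterTypes⁻ τ∈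
  ... | z , refl , _ = char-determines-type Φ u z u⊨

  ⊨char⇒InCluster : ∀ {x τ y} → τ ∈ clusterTypes x → M , y ⊨ char Φ τ → InCluster y
  ⊨char⇒InCluster τ∈ y⊨ with ∈-clusterTypes⁻ τ∈
  ... | z , type-z≡τ , _ , z∈C =
    SameCluster-respʳ-≈Φ sc (type≡⇒≈Φ (trans type-z≡τ (sym (⊨char⇒type≡ τ∈ y⊨)))) z∈C

  Minimal : W M → Set
  Minimal x = ∀ y → InCluster y → length (clusterTypes x) ≤ length (clusterTypes y)

  minimal-clusterTypes-stable : ∀ {x y} → Minimal x → R M x y → InCluster y →
                                clusterTypes y ≡ clusterTypes x
  minimal-clusterTypes-stable minimal xRy y∈C =
    ≋⇒≡ (Sublist.to-≋ (≤-antisym (Sublist.length-mono-≤ y⊆x) (minimal _ y∈C)) y⊆x)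
    where y⊆x = clusterTypes-antitone xRy

  minimal-sees : ∀ {x y τ} → Minimal x → R M x y → InCluster y →
                 τ ∈ clusterTypes x → SeesInCluster y τ
  minimal-sees minimal xRy y∈C τ∈ =
    ∈-clusterTypes⁻ (subst (_ ∈_) (sym (minimal-clusterTypes-stable minimal xRy y∈C)) τ∈)

  module _ {x} (minimal : Minimal x) {n} (n<len : n < length (clusterTypes x)) where

    τ : Fin (suc n) → List Bool
    τ i = lookup (clusterTypes x) (inject≤ i n<len)

    τ∈ : ∀ i → τ i ∈ clusterTypes x
    τ∈ i = ∈-lookup (inject≤ i n<len)

    φ : Fin (suc n) → Fm
    φ i = char Φ (τ i)

    ⊨𝔻-φ : ∀ u → M , u ⊨ 𝔻 n φ
    ⊨𝔻-φ u = ⊨𝔻 n φ λ i j i≢j ⊨φᵢ ⊨φⱼ →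
      i≢j (inject≤-injective _ _ i j (lookup-injective clusterTypes-unique
            (trans (sym (⊨char⇒type≡ (τ∈ i) ⊨φᵢ)) (⊨char⇒type≡ (τ∈ j) ⊨φⱼ))))

    ⊨◇φ₀ : M , x ⊨ ◇ (φ zero)
    ⊨◇φ₀ with ∈-clusterTypes⁻ (τ∈ zero)
    ... | z , type-z≡τ₀ , xRz , _ = ◇-intro (φ zero) xRz (⊨char-type Φ type-z≡τ₀)

    φ₀⇒ℙ : ∀ y → R M x y → M , y ⊨ φ zero → M , y ⊨ ℙ n φ
    φ₀⇒ℙ y xRy ⊨φ₀ =
      ⊨ℙ (λ u → R M x u × InCluster u) n φ reach (xRy , ⊨char⇒InCluster (τ∈ zero) ⊨φ₀)
      where
      reach : ∀ {u} i → R M x u × InCluster u →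
              ∃[ z ] R M u z × (R M x z × InCluster z) × M , z ⊨ φ i
      reach i (xRu , u∈C) with minimal-sees minimal xRu u∈C (τ∈ i)
      ... | z , type-z≡τᵢ , uRz , z∈C = z , uRz , (tr _ _ _ xRu uRz , z∈C) , ⊨char-type Φ type-z≡τᵢ

    ⊭ℂ-φ : ¬ (M , x ⊨ ℂ n φ)
    ⊭ℂ-φ = ⊭ℂ {φ = φ} (⊨𝔻-φ x , λ y _ → ⊨𝔻-φ y) ⊨◇φ₀ φ₀⇒ℙ

  minimal-clusterTypes-bounded : ∀ n → ValidC n M → ∀ {x} → Minimal x → length (clusterTypes x) ≤ n
  minimal-clusterTypes-bounded n valid {x} minimal =
    ≮⇒≥ λ n<len → ⊭ℂ-φ minimal n<len (valid (φ minimal n<len) x)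

  centre : ∃[ x ] InCluster x × Minimal x
  centre = minimiser em InCluster (length ∘ clusterTypes) (inj₁ ≈Φ-refl)

  x* : W M
  x* = proj₁ centre

  x*∈C : InCluster x*
  x*∈C = proj₁ (proj₂ centre)

  x*-minimal : Minimal x*
  x*-minimal = proj₂ (proj₂ centre)

  clusterTypes-seen : All (SeesInCluster x*) (clusterTypes x*)
  clusterTypes-seen = all-filter (SeesInCluster? x*) (boolVectors (length Φ))

  C* : List (W M)
  C* = witnesses clusterTypes-seen

  ∈-C*⁻ : ∀ {w} → w ∈ C* → R M x* w × InCluster w
  ∈-C*⁻ w∈ = let _ , _ , x*Rw , w∈C = ∈-witnesses⁻ clusterTypes-seen w∈ in x*Rw , w∈C

  C*-covers : ∀ {y} → R M x* y → InCluster y → ∃[ w ] w ∈ C* × M ∣ Φ ⊢ w ≈Φ y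
  C*-covers {y} x*Ry y∈C =
    let w , w∈ , type-w≡ , _ =
          ∈-witnesses⁺ clusterTypes-seen (∈-clusterTypes⁺ (y , refl , x*Ry , y∈C))
    in w , w∈ , type≡⇒≈Φ type-w≡

  C*-reached : ∀ {y w} → R M x* y → InCluster y → w ∈ C* → M ∣ Φ ⊢ y ⇝ w
  C*-reached {w = w} x*Ry y∈C w∈ =
    let x*Rw , w∈C = ∈-C*⁻ w∈
        z , type-z≡ , yRz , _ =
          minimal-sees x*-minimal x*Ry y∈C (∈-clusterTypes⁺ (w , refl , x*Rw , w∈C))
    in z , type≡⇒≈Φ (sym type-z≡) , yRz

  C*-bounded : ∀ n → ValidC n M → length C* ≤ n
  C*-bounded n valid =
    ≤-trans (≤-reflexive (length-witnesses clusterTypes-seen))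
            (minimal-clusterTypes-bounded n valid x*-minimal)

  C*-degenerate : Degenerate M Φ c → C* ≡ []
  C*-degenerate degenerate = ≡[]-if-no-members C* λ w∈ →
    let x*Rw , w∈C = ∈-C*⁻ w∈ in Degenerate⇒¬R tr sc degenerate x*∈C w∈C x*Rw

lemma6p1 : ExcludedMiddle 0ℓ →
    (n : ℕ) (M : Model) → Transitive M → ValidC n M →
    (Φ : List Fm) → SubClosed Φ →
    (c : W M) →
    Σ (W M) λ x* → Σ (List (W M)) λ Cs →
      SameCluster M Φ c x* ×
      (∀ w → w ∈ Cs → SameCluster M Φ c w) ×
      (∀ w → w ∈ Cs → M ∣ Φ ⊢ x* ⇝ w) ×
      (∀ y → R M x* y → SameCluster M Φ c y →
        (Σ (W M) λ w → w ∈ Cs × M ∣ Φ ⊢ w ≈Φ y) ×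
        (∀ w → w ∈ Cs → M ∣ Φ ⊢ y ⇝ w)) ×
      length Cs ≤ n ×
      (Degenerate M Φ c → Cs ≡ [])
lemma6p1 em n M tr valid Φ sc c =
  x* , C* , x*∈C ,
  (λ _ w∈ → proj₂ (∈-C*⁻ w∈)) ,
  (λ w w∈ → w , ≈Φ-refl , proj₁ (∈-C*⁻ w∈)) ,
  (λ _ x*Ry y∈C → C*-covers x*Ry y∈C , λ _ → C*-reached x*Ry y∈C) ,
  C*-bounded n valid ,
  C*-degenerate
  where open Cluster em M tr Φ sc c
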